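{- Let $P\in S_n$ and let $\mathcal{T}$ be a block decomposition tree of $P$. Then \[\mathrm{OPT}(P)\ \ge\ \sum_{v\in N(\mathcal{T})}\mathrm{OPT}(\tilde P_v)+\sum_{v\in L(\mathcal{T})}\mathrm{OPT}(P_v)\ -\ 2n,\] where $\tilde P_v$ is the skeleton of the non-leaf node $v$ and $P_v$ the permutation associated with the leaf $v$.
   Context: $P=(x_1,\dots,x_n)$ is identified with the point set $\{(x_t,t)\}$. A point set $S$ is satisfied if for all $p,q\in S$ differing in both coordinates the closed axis-parallel rectangle with corners $p,q$ contains a point of $S$ other than $p,q$; $\mathrm{OPT}(Q)$ for a permutation $Q$ is the minimum size of a satisfied superset of its point set. Blocks: a time interval $[a,b]$ with $\{x_a,\dots,x_b\}=[c,d]$ an interval; region $[c,d]\times[a,b]$. A block decomposition tree $\mathcal{T}$ is a rooted tree of blocks with root $[n]\times[n]$, each node being a leaf or having children $P_1,\dots,P_k$ ($k\ge2$), blocks whose time intervals partition the node's time interval into consecutive intervals. The skeleton of a non-leaf node is the permutation of $[k]$ order-isomorphic to $(r_1,\dots,r_k)$ with $r_j$ any key of $P_j$ (children in time order); a leaf is associated with the permutation order-isomorphic to the restriction of $P$ to it. $N(\mathcal{T})$, $L(\mathcal{T})$ are the non-leaf and leaf nodes. -}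

module Defs where

open import Data.Nat using (ℕ; zero; suc; _+_; _*_; _∸_; _≤_; _<_; _<?_; _⊓_; _⊔_)
open import Data.Product using (Σ; ∃; ∃-syntax; _×_; _,_; proj₁; proj₂)
open import Data.List using (List; []; _∷_; length; map; filter; take; drop; zip; applyUpTo)
open import Data.List.Membership.Propositional using (_∈_)
open import Data.List.Relation.Unary.All using (All)
open import Data.List.Relation.Unary.Unique.Propositional using (Unique)
open import Data.List.Relation.Binary.Permutation.Propositional using (_↭_)
open import Relation.Binary.PropositionalEquality using (_≡_; _≢_)

-- Sequences / permutations (values and times are 1-indexed)

range : ℕ → List ℕ
range n = applyUpTo suc n

IsPerm : ℕ → List ℕ → Set
IsPerm n P = P ↭ range n

-- x_t (1-indexed; 0 if out of range)
at : List ℕ → ℕ → ℕ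
at []       _             = 0
at (x ∷ xs) zero          = 0
at (x ∷ xs) (suc zero)    = x
at (x ∷ xs) (suc (suc t)) = at xs (suc t)

-- (x_a, …, x_b)
seg : List ℕ → ℕ → ℕ → List ℕ
seg P a b = take (suc b ∸ a) (drop (a ∸ 1) P)

-- standardisation: the permutation order-isomorphic to a sequence of
-- distinct naturals (each entry replaced by 1 + number of smaller entries)
std : List ℕ → List ℕ
std xs = map (λ x → suc (length (filter (_<? x) xs))) xs

Point : Set
Point = ℕ × ℕ

points : List ℕ → List Point
points Q = zip Q (range (length Q))

InRect : Point → Point → Point → Set
InRect (px , py) (qx , qy) (rx , ry) =
  (px ⊓ qx ≤ rx) × (rx ≤ px ⊔ qx) × (py ⊓ qy ≤ ry) × (ry ≤ py ⊔ qy)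

Satisfied : List Point → Set
Satisfied S = ∀ p q → p ∈ S → q ∈ S → proj₁ p ≢ proj₁ q → proj₂ p ≢ proj₂ q →
  ∃[ r ] (r ∈ S × r ≢ p × r ≢ q × InRect p q r)

-- S is a (duplicate-free, hence |S| = length S) satisfied superset of Q's points
SatSuperset : List ℕ → List Point → Set
SatSuperset Q S = Unique S × All (_∈ S) (points Q) × Satisfied S

IsOPT : List ℕ → ℕ → Set
IsOPT Q k = (∃[ S ] (SatSuperset Q S × length S ≡ k))
          × (∀ S → SatSuperset Q S → k ≤ length S)

IsBlock : List ℕ → ℕ → ℕ → Set
IsBlock P a b = (1 ≤ a) × (a ≤ b) × (b ≤ length P) ×
  ∃[ c ] ∃[ d ] (∀ v → (v ∈ seg P a b → c ≤ v × v ≤ d) × (c ≤ v × v ≤ d → v ∈ seg P a b))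

mutual
  -- BDT P a b : a block decomposition (sub)tree whose root is the block
  -- with time interval [a,b]
  data BDT (P : List ℕ) : ℕ → ℕ → Set where
    leaf : ∀ {a b} → IsBlock P a b → BDT P a b
    -- first child on [a,m], remaining (≥ 1) children partition [m+1,b]
    node : ∀ {a m b} → IsBlock P a b → BDT P a m → Kids P (suc m) b → BDT P a b

  data Kids (P : List ℕ) : ℕ → ℕ → Set where
    lastK : ∀ {a b} → BDT P a b → Kids P a b
    consK : ∀ {a m b} → BDT P a m → Kids P (suc m) b → Kids P a b

-- keys (x at the first time) of the children, in time order
keys : ∀ {P a b} → Kids P a b → List ℕ
keys {P} {a} (lastK _)    = at P a ∷ []
keys {P} {a} (consK _ ks) = at P a ∷ keys ks

skeleton : ∀ {P m b} (a : ℕ) → Kids P (suc m) b → List ℕ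
skeleton {P} a ks = std (at P a ∷ keys ks)

mutual
  -- TreeSum T s : s = Σ_{v ∈ N(T)} OPT(skeleton v) + Σ_{v ∈ L(T)} OPT(P_v)
  data TreeSum {P : List ℕ} : ∀ {a b} → BDT P a b → ℕ → Set where
    leafS : ∀ {a b k} {β : IsBlock P a b} →
            IsOPT (std (seg P a b)) k → TreeSum (leaf β) k
    nodeS : ∀ {a m b k s₁ s₂} {β : IsBlock P a b} {t : BDT P a m} {ks : Kids P (suc m) b} →
            IsOPT (skeleton a ks) k → TreeSum t s₁ → KidsSum ks s₂ →
            TreeSum (node β t ks) (k + s₁ + s₂)

  data KidsSum {P : List ℕ} : ∀ {a b} → Kids P a b → ℕ → Set where
    lastS : ∀ {a b s} {t : BDT P a b} → TreeSum t s → KidsSum (lastK t) s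
    consS : ∀ {a m b s₁ s₂} {t : BDT P a m} {ks : Kids P (suc m) b} →
            TreeSum t s₁ → KidsSum ks s₂ → KidsSum (consK t ks) (s₁ + s₂)

-- Fix a satisfied superset S of the points of P with |S| = OPT(P) and show by
-- induction on T the invariant: for a subtree t rooted at the block on times [a,b] with tree
-- sum s, and any satisfied S containing the points of P at the times in [a,b],
--   s + 2 ≤ |S| + 2 (b − a + 1);
-- at the root this is s + 2 ≤ OPT(P) + 2n. Two facts about satisfied sets drive the
-- induction: restricting to an axis-parallel box keeps a set satisfied, and so does taking
-- its image under a coordinatewise monotone map of the plane (MonotoneImage).
-- * Leaf: normalising the block's region to [1,k]² maps S ∩ region onto a satisfied superset
--   of the leaf's pattern, so OPT(pattern) ≤ |S ∩ region| (leaf-bound).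
-- * Node with K ≥ 2 children: the monotone map contracting each child region to a single
--   point sends S ∩ region onto a satisfied superset of the skeleton, covered by the K
--   skeleton points and the images of the A points outside all children, so
--   OPT(skeleton) ≤ K + A (skeleton-bound). The children's regions are disjoint and avoid
--   those A points, so the children's invariants add up to the node's (tree-bound).

module Submission where

open import Defs
open import Data.Nat using (ℕ; zero; suc; _+_; _*_; _∸_; _≤_; _<_; _⊓_; _⊔_; z≤n; s≤s; ∣_-_∣)
open import Data.Nat.Properties
open import Data.Nat.Solver using (module +-*-Solver)
open import Data.Empty using (⊥; ⊥-elim)
open import Data.Product using (∃-syntax; _×_; _,_; proj₁; proj₂)
open import Data.Product.Properties using (≡-dec)
open import Data.Sum using (_⊎_; inj₁; inj₂)
open import Data.List using (List; []; _∷_; length; map; filter; take; drop; zip; applyUpTo; _++_; deduplicate)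
open import Data.List.Properties using (length-++; length-map; length-applyUpTo; length-filter; filter-accept; filter-none; length-take; length-drop; length-zipWith)
open import Data.List.Membership.Propositional using (_∈_; find)
open import Data.List.Membership.Propositional.Properties
open import Data.List.Relation.Unary.Any using (Any; here; there; any?)
open import Data.List.Relation.Unary.All as All using (All; []; _∷_)
open import Data.List.Relation.Unary.AllPairs using (AllPairs; []; _∷_)
open import Data.List.Relation.Unary.Unique.Propositional using (Unique)
open import Data.List.Relation.Unary.Unique.Propositional.Properties using (applyUpTo⁺₁; filter⁺; take⁺; drop⁺)
import Data.List.Relation.Unary.Unique.DecPropositional.Properties as UniqueDec
open import Data.List.Relation.Binary.Permutation.Propositional using (↭-sym; ↭⇒↭ₛ)
open import Data.List.Relation.Binary.Permutation.Propositional.Properties using (↭-length)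
import Data.List.Relation.Binary.Permutation.Setoid.Properties as PermSetoid
open import Relation.Binary.PropositionalEquality using (_≡_; _≢_; refl; sym; trans; cong; cong₂; subst; subst₂; setoid; module ≡-Reasoning)
open import Relation.Nullary using (¬_; Dec; yes; no; ¬?)
open import Relation.Nullary.Decidable using (_×-dec_)
open import Relation.Unary using (Decidable)

-- nth xs t is the entry at 0-based position t (0 when out of range);
-- the 1-based lookup 'at' of the statement is 'nth' shifted by one.
nth : List ℕ → ℕ → ℕ
nth []       _       = 0
nth (x ∷ xs) zero    = x
nth (x ∷ xs) (suc t) = nth xs t

at≡nth : ∀ xs t → at xs (suc t) ≡ nth xs t
at≡nth []       t       = refl
at≡nth (x ∷ xs) zero    = refl
at≡nth (x ∷ xs) (suc t) = at≡nth xs t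

∈⇒nth : ∀ {v xs} → v ∈ xs → ∃[ t ] (t < length xs × v ≡ nth xs t)
∈⇒nth (here refl) = 0 , s≤s z≤n , refl
∈⇒nth (there v∈xs) with ∈⇒nth v∈xs
... | t , t<len , v≡ = suc t , s≤s t<len , v≡

nth-∈ : ∀ xs t → t < length xs → nth xs t ∈ xs
nth-∈ (x ∷ xs) zero    _         = here refl
nth-∈ (x ∷ xs) (suc t) (s≤s t<n) = there (nth-∈ xs t t<n)

nth-map : ∀ (f : ℕ → ℕ) xs t → t < length xs → nth (map f xs) t ≡ f (nth xs t)
nth-map f (x ∷ xs) zero    _         = refl
nth-map f (x ∷ xs) (suc t) (s≤s t<n) = nth-map f xs t t<n

nth-take : ∀ n xs t → t < n → nth (take n xs) t ≡ nth xs t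
nth-take (suc n) []       t       _         = refl
nth-take (suc n) (x ∷ xs) zero    _         = refl
nth-take (suc n) (x ∷ xs) (suc t) (s≤s t<n) = nth-take n xs t t<n

nth-drop : ∀ k xs t → nth (drop k xs) t ≡ nth xs (k + t)
nth-drop zero    xs       t = refl
nth-drop (suc k) []       t = refl
nth-drop (suc k) (x ∷ xs) t = nth-drop k xs t

nth-injective : ∀ {xs} → Unique xs → ∀ t u → t < length xs → u < length xs →
  nth xs t ≡ nth xs u → t ≡ u
nth-injective          (_ ∷ _)   zero    zero    _         _         _ = refl
nth-injective {x ∷ xs} (x∉ ∷ _)  zero    (suc u) _         (s≤s u<n) e =
  ⊥-elim (All.lookup x∉ (nth-∈ xs u u<n) e)
nth-injective {x ∷ xs} (x∉ ∷ _)  (suc t) zero    (s≤s t<n) _         e =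
  ⊥-elim (All.lookup x∉ (nth-∈ xs t t<n) (sym e))
nth-injective          (_ ∷ uxs) (suc t) (suc u) (s≤s t<n) (s≤s u<n) e =
  cong suc (nth-injective uxs t u t<n u<n e)

nth∈zip : ∀ xs (g : ℕ → ℕ) t → t < length xs → (nth xs t , g t) ∈ zip xs (applyUpTo g (length xs))
nth∈zip (x ∷ xs) g zero    _         = here refl
nth∈zip (x ∷ xs) g (suc t) (s≤s t<n) = there (nth∈zip xs (λ i → g (suc i)) t t<n)

zip∈⇒nth : ∀ xs (g : ℕ → ℕ) {v i} → (v , i) ∈ zip xs (applyUpTo g (length xs)) →
  ∃[ t ] (t < length xs × v ≡ nth xs t × i ≡ g t)
zip∈⇒nth (x ∷ xs) g (here refl) = 0 , s≤s z≤n , refl , refl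
zip∈⇒nth (x ∷ xs) g (there p) with zip∈⇒nth xs (λ i → g (suc i)) p
... | t , t<n , v≡ , i≡ = suc t , s≤s t<n , v≡ , i≡

nth∈points : ∀ Q t → t < length Q → (nth Q t , suc t) ∈ points Q
nth∈points Q = nth∈zip Q suc

points∈⇒nth : ∀ Q {v i} → (v , i) ∈ points Q → ∃[ t ] (t < length Q × v ≡ nth Q t × i ≡ suc t)
points∈⇒nth Q = zip∈⇒nth Q suc

length-points : ∀ Q → length (points Q) ≡ length Q
length-points Q = begin
  length (points Q)                    ≡⟨ length-zipWith _,_ Q (range (length Q)) ⟩
  length Q ⊓ length (range (length Q)) ≡⟨ cong (length Q ⊓_) (length-applyUpTo suc (length Q)) ⟩
  length Q ⊓ length Q                  ≡⟨ ⊓-idem (length Q) ⟩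
  length Q                             ∎
  where open ≡-Reasoning

unique-⊆⇒length≤ : ∀ {A : Set} {xs ys : List A} → Unique xs → (∀ {z} → z ∈ xs → z ∈ ys) →
  length xs ≤ length ys
unique-⊆⇒length≤ {xs = []}     _           _   = z≤n
unique-⊆⇒length≤ {xs = x ∷ xs} (x∉ ∷ uxs) xs⊆ with ∈-∃++ (xs⊆ (here refl))
... | ys₁ , ys₂ , refl = subst (suc (length xs) ≤_) (sym length-split)
                           (s≤s (unique-⊆⇒length≤ uxs xs⊆ys₁ys₂))
  where
  length-split : length (ys₁ ++ x ∷ ys₂) ≡ suc (length (ys₁ ++ ys₂))
  length-split = trans (length-++ ys₁)
    (trans (+-suc (length ys₁) (length ys₂)) (cong suc (sym (length-++ ys₁))))
  xs⊆ys₁ys₂ : ∀ {z} → z ∈ xs → z ∈ ys₁ ++ ys₂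
  xs⊆ys₁ys₂ z∈xs with ∈-++⁻ ys₁ (xs⊆ (there z∈xs))
  ... | inj₁ z∈ys₁         = ∈-++⁺ˡ z∈ys₁
  ... | inj₂ (here refl)   = ⊥-elim (All.lookup x∉ z∈xs refl)
  ... | inj₂ (there z∈ys₂) = ∈-++⁺ʳ ys₁ z∈ys₂

satisfied-≐ : ∀ {A B} → Satisfied A → (∀ {z} → z ∈ B → z ∈ A) → (∀ {z} → z ∈ A → z ∈ B) →
  Satisfied B
satisfied-≐ satA B⊆A A⊆B p q p∈B q∈B x≢ y≢ with satA p q (B⊆A p∈B) (B⊆A q∈B) x≢ y≢
... | r , r∈A , r≢p , r≢q , r∈pq = r , A⊆B r∈A , r≢p , r≢q , r∈pq

_≟ₚ_ : (p q : Point) → Dec (p ≡ q)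
_≟ₚ_ = ≡-dec _≟_ _≟_

-- OPT(Q) is at most the size of any list Y containing a satisfied set W ⊇ points(Q);
-- W need not be duplicate-free: its deduplication is a satisfied superset
OPT≤ : ∀ {Q k} (W Y : List Point) → IsOPT Q k → Satisfied W →
  (∀ {z} → z ∈ points Q → z ∈ W) → (∀ {z} → z ∈ W → z ∈ Y) → k ≤ length Y
OPT≤ {Q} W Y (_ , minimal) satW Q⊆W W⊆Y =
  ≤-trans (minimal W′ (unique , All.tabulate (λ z∈Q → ∈-deduplicate⁺ _≟ₚ_ (Q⊆W z∈Q)) , satW′))
          (unique-⊆⇒length≤ unique (λ z∈W′ → W⊆Y (∈-deduplicate⁻ _≟ₚ_ W z∈W′)))
  where
  W′ : List Point
  W′ = deduplicate _≟ₚ_ W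
  unique : Unique W′
  unique = UniqueDec.deduplicate-! _≟ₚ_ W
  satW′ : Satisfied W′
  satW′ = satisfied-≐ satW (∈-deduplicate⁻ _≟ₚ_ W) (∈-deduplicate⁺ _≟ₚ_)

between-closer : ∀ {p q r} → p ⊓ q ≤ r → r ≤ p ⊔ q →
  ∣ r - q ∣ ≤ ∣ p - q ∣ × (r ≢ p → ∣ r - q ∣ < ∣ p - q ∣)
between-closer {p} {q} {r} lo hi with ≤-total p q
... | inj₁ p≤q rewrite m≤n⇒m⊓n≡m p≤q | m≤n⇒m⊔n≡n p≤q
                     | m≤n⇒∣m-n∣≡n∸m hi | m≤n⇒∣m-n∣≡n∸m p≤q =
  ∸-monoʳ-≤ q lo , λ r≢p → ∸-monoʳ-< (≤∧≢⇒< lo (λ e → r≢p (sym e))) hi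
... | inj₂ q≤p rewrite m≥n⇒m⊓n≡n q≤p | m≥n⇒m⊔n≡m q≤p
                     | m≤n⇒∣n-m∣≡n∸m lo | m≤n⇒∣n-m∣≡n∸m q≤p =
  ∸-monoˡ-≤ q hi , λ r≢p → ∸-monoˡ-< (≤∧≢⇒< hi r≢p) lo

-- ℓ¹ distance of points; it strictly decreases when a corner of a rectangle is
-- replaced by another point of the rectangle
dist : Point → Point → ℕ
dist (px , py) (qx , qy) = ∣ px - qx ∣ + ∣ py - qy ∣

dist-sym : ∀ p q → dist p q ≡ dist q p
dist-sym (px , py) (qx , qy) = cong₂ _+_ (∣-∣-comm px qx) (∣-∣-comm py qy)

InRect-sym : ∀ p q r → InRect p q r → InRect q p r
InRect-sym (px , py) (qx , qy) _ rect
  rewrite ⊓-comm px qx | ⊔-comm px qx | ⊓-comm py qy | ⊔-comm py qy = rect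

InRect⇒closerˡ : ∀ p q r → InRect p q r → r ≢ p → dist r q < dist p q
InRect⇒closerˡ (px , py) (qx , qy) (rx , ry) (lx , hx , ly , hy) r≢p with rx ≟ px
... | yes refl = +-mono-≤-< (proj₁ (between-closer lx hx))
                            (proj₂ (between-closer ly hy) (λ e → r≢p (cong (px ,_) e)))
... | no rx≢px = +-mono-<-≤ (proj₂ (between-closer lx hx) rx≢px) (proj₁ (between-closer ly hy))

InRect⇒closerʳ : ∀ p q r → InRect p q r → r ≢ q → dist p r < dist p q
InRect⇒closerʳ p q r rect r≢q
  rewrite dist-sym p r | dist-sym p q = InRect⇒closerˡ q p r (InRect-sym p q r rect) r≢q

Monotone : (ℕ → ℕ) → Set
Monotone g = ∀ {x y} → x ≤ y → g x ≤ g y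

module MonotoneImage (g h : ℕ → ℕ) (g-mono : Monotone g) (h-mono : Monotone h) where

  image : Point → Point
  image (x , y) = (g x , h y)

  image-InRect : ∀ p q r → InRect p q r → InRect (image p) (image q) (image r)
  image-InRect (px , py) (qx , qy) (rx , ry) (lx , hx , ly , hy) =
    below g g-mono lx , above g g-mono hx , below h h-mono ly , above h h-mono hy
    where
    below : ∀ f → Monotone f → ∀ {a b c} → a ⊓ b ≤ c → f a ⊓ f b ≤ f c
    below f f-mono {a} {b} le = subst (_≤ _) (mono-≤-distrib-⊓ f-mono a b) (f-mono le)
    above : ∀ f → Monotone f → ∀ {a b c} → c ≤ a ⊔ b → f c ≤ f a ⊔ f b
    above f f-mono {a} {b} le = subst (_ ≤_) (mono-≤-distrib-⊔ f-mono a b) (f-mono le)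

  module _ (S : List Point) (satS : Satisfied S) where

    -- a witness for p, q in S whose image differs from both image corners: if the witness r
    -- of S collapses onto a corner, recurse on the rectangle spanned by r and the other corner,
    -- which is strictly shorter (the fuel bounds the distance)
    image-witness : ∀ fuel p q → dist p q < fuel → p ∈ S → q ∈ S →
      g (proj₁ p) ≢ g (proj₁ q) → h (proj₂ p) ≢ h (proj₂ q) →
      ∃[ r ] (r ∈ map image S × r ≢ image p × r ≢ image q × InRect (image p) (image q) r)
    image-witness (suc fuel) p q (s≤s d<fuel) p∈S q∈S gx≢ hy≢
      with satS p q p∈S q∈S (λ e → gx≢ (cong g e)) (λ e → hy≢ (cong h e))
    ... | r , r∈S , r≢p , r≢q , r∈pq with image r ≟ₚ image p | image r ≟ₚ image q
    ... | yes r↦p | _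
      with image-witness fuel r q (<-≤-trans (InRect⇒closerˡ p q r r∈pq r≢p) d<fuel) r∈S q∈S
             (subst (_≢ g (proj₁ q)) (sym (cong proj₁ r↦p)) gx≢)
             (subst (_≢ h (proj₂ q)) (sym (cong proj₂ r↦p)) hy≢)
    ... | w , w∈ , w≢r , w≢q , w∈rq =
      w , w∈ , subst (w ≢_) r↦p w≢r , w≢q , subst (λ c → InRect c (image q) w) r↦p w∈rq
    image-witness (suc fuel) p q (s≤s d<fuel) p∈S q∈S gx≢ hy≢
      | r , r∈S , r≢p , r≢q , r∈pq | no _ | yes r↦q
      with image-witness fuel p r (<-≤-trans (InRect⇒closerʳ p q r r∈pq r≢q) d<fuel) p∈S r∈S
             (subst (g (proj₁ p) ≢_) (sym (cong proj₁ r↦q)) gx≢)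
             (subst (h (proj₂ p) ≢_) (sym (cong proj₂ r↦q)) hy≢)
    ... | w , w∈ , w≢p , w≢r , w∈pr =
      w , w∈ , w≢p , subst (w ≢_) r↦q w≢r , subst (λ c → InRect (image p) c w) r↦q w∈pr
    image-witness (suc fuel) p q (s≤s d<fuel) p∈S q∈S gx≢ hy≢
      | r , r∈S , r≢p , r≢q , r∈pq | no r↛p | no r↛q =
      image r , ∈-map⁺ image r∈S , r↛p , r↛q , image-InRect p q r r∈pq

    image-satisfied : Satisfied (map image S)
    image-satisfied _ _ p∈ q∈ x≢ y≢ with ∈-map⁻ image p∈ | ∈-map⁻ image q∈
    ... | p , p∈S , refl | q , q∈S , refl =
      image-witness (suc (dist p q)) p q ≤-refl p∈S q∈S x≢ y≢

Convex : (Point → Set) → Set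
Convex R = ∀ p q r → R p → R q → InRect p q r → R r

restrict-satisfied : ∀ {R : Point → Set} (R? : Decidable R) → Convex R →
  ∀ S → Satisfied S → Satisfied (filter R? S)
restrict-satisfied R? convex S satS p q p∈ q∈ x≢ y≢
  with ∈-filter⁻ R? p∈ | ∈-filter⁻ R? q∈
... | p∈S , Rp | q∈S , Rq with satS p q p∈S q∈S x≢ y≢
... | r , r∈S , r≢p , r≢q , r∈pq =
  r , ∈-filter⁺ R? r∈S (convex p q r Rp Rq r∈pq) , r≢p , r≢q , r∈pq

InBox : ℕ → ℕ → ℕ → ℕ → Point → Set
InBox c d a b (x , y) = c ≤ x × x ≤ d × a ≤ y × y ≤ b

InBox? : ∀ c d a b → Decidable (InBox c d a b)
InBox? c d a b (x , y) = (c ≤? x) ×-dec (x ≤? d) ×-dec (a ≤? y) ×-dec (y ≤? b)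

InBox-convex : ∀ c d a b → Convex (InBox c d a b)
InBox-convex c d a b _ _ _ (p₁ , p₂ , p₃ , p₄) (q₁ , q₂ , q₃ , q₄) (lx , hx , ly , hy) =
  ≤-trans (⊓-glb p₁ q₁) lx , ≤-trans hx (⊔-lub p₂ q₂) ,
  ≤-trans (⊓-glb p₃ q₃) ly , ≤-trans hy (⊔-lub p₄ q₄)

module _ {A : Set} where

  count-disjoint : ∀ {P Q R : A → Set} (P? : Decidable P) (Q? : Decidable Q) (R? : Decidable R) →
    (∀ x → P x → Q x → ⊥) → (∀ x → P x → R x) → (∀ x → Q x → R x) →
    ∀ xs → length (filter P? xs) + length (filter Q? xs) ≤ length (filter R? xs)
  count-disjoint P? Q? R? P∩Q P⊆R Q⊆R [] = z≤n
  count-disjoint P? Q? R? P∩Q P⊆R Q⊆R (x ∷ xs) with P? x | Q? x | R? x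
  ... | yes p | yes q | _     = ⊥-elim (P∩Q x p q)
  ... | yes p | no _  | no ¬r = ⊥-elim (¬r (P⊆R x p))
  ... | no _  | yes q | no ¬r = ⊥-elim (¬r (Q⊆R x q))
  ... | yes _ | no _  | yes _ = s≤s (count-disjoint P? Q? R? P∩Q P⊆R Q⊆R xs)
  ... | no _  | yes _ | yes _ =
    subst (_≤ suc (length (filter R? xs))) (sym (+-suc (length (filter P? xs)) (length (filter Q? xs))))
          (s≤s (count-disjoint P? Q? R? P∩Q P⊆R Q⊆R xs))
  ... | no _  | no _  | yes _ = m≤n⇒m≤1+n (count-disjoint P? Q? R? P∩Q P⊆R Q⊆R xs)
  ... | no _  | no _  | no _  = count-disjoint P? Q? R? P∩Q P⊆R Q⊆R xs

  count-mono : ∀ {P Q : A → Set} (P? : Decidable P) (Q? : Decidable Q) → (∀ x → P x → Q x) →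
    ∀ xs → length (filter P? xs) ≤ length (filter Q? xs)
  count-mono P? Q? P⊆Q [] = z≤n
  count-mono P? Q? P⊆Q (x ∷ xs) with P? x | Q? x
  ... | yes p | no ¬q = ⊥-elim (¬q (P⊆Q x p))
  ... | yes _ | yes _ = s≤s (count-mono P? Q? P⊆Q xs)
  ... | no _  | yes _ = m≤n⇒m≤1+n (count-mono P? Q? P⊆Q xs)
  ... | no _  | no _  = count-mono P? Q? P⊆Q xs

  count-cong : ∀ {P Q : A → Set} (P? : Decidable P) (Q? : Decidable Q) →
    ∀ xs → (∀ {x} → x ∈ xs → (P x → Q x) × (Q x → P x)) →
    length (filter P? xs) ≡ length (filter Q? xs)
  count-cong P? Q? [] _ = refl
  count-cong P? Q? (x ∷ xs) P⇔Q with P? x | Q? x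
  ... | yes p | no ¬q = ⊥-elim (¬q (proj₁ (P⇔Q (here refl)) p))
  ... | no ¬p | yes q = ⊥-elim (¬p (proj₂ (P⇔Q (here refl)) q))
  ... | yes _ | yes _ = cong suc (count-cong P? Q? xs (λ x∈ → P⇔Q (there x∈)))
  ... | no _  | no _  = count-cong P? Q? xs (λ x∈ → P⇔Q (there x∈))

  count-none : ∀ {P : A → Set} (P? : Decidable P) xs → (∀ {x} → x ∈ xs → ¬ P x) →
    length (filter P? xs) ≡ 0
  count-none P? xs none = cong length (filter-none P? (All.tabulate none))

  count-map : ∀ {P : ℕ → Set} (P? : Decidable P) (f : A → ℕ) xs →
    length (filter P? (map f xs)) ≡ length (filter (λ x → P? (f x)) xs)
  count-map P? f [] = refl
  count-map P? f (x ∷ xs) with P? (f x)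
  ... | yes _ = cong suc (count-map P? f xs)
  ... | no _  = count-map P? f xs

count-below-interval : ∀ xs c d x → Unique xs →
  (∀ {v} → v ∈ xs → c ≤ v × v ≤ d) → (∀ {v} → c ≤ v → v ≤ d → v ∈ xs) →
  c ≤ x → x ≤ d → length (filter (_<? x) xs) ≡ x ∸ c
count-below-interval xs c d x uxs xs⊆ ⊆xs c≤x x≤d =
  ≤-antisym (subst (_ ≤_) (length-applyUpTo (c +_) (x ∸ c)) (unique-⊆⇒length≤ (filter⁺ (_<? x) uxs) below⊆c⋯x))
            (subst (_≤ _) (length-applyUpTo (c +_) (x ∸ c)) (unique-⊆⇒length≤ unique-c⋯x c⋯x⊆below))
  where
  c⋯x : List ℕ
  c⋯x = applyUpTo (c +_) (x ∸ c)
  unique-c⋯x : Unique c⋯x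
  unique-c⋯x = applyUpTo⁺₁ (c +_) (x ∸ c) (λ i<j _ e → <⇒≢ i<j (+-cancelˡ-≡ c _ _ e))
  below⊆c⋯x : ∀ {v} → v ∈ filter (_<? x) xs → v ∈ c⋯x
  below⊆c⋯x v∈ with ∈-filter⁻ (_<? x) v∈
  ... | v∈xs , v<x = subst (_∈ c⋯x) (m+[n∸m]≡n (proj₁ (xs⊆ v∈xs)))
                       (∈-applyUpTo⁺ (c +_) (∸-monoˡ-< v<x (proj₁ (xs⊆ v∈xs))))
  c⋯x⊆below : ∀ {v} → v ∈ c⋯x → v ∈ filter (_<? x) xs
  c⋯x⊆below v∈ with ∈-applyUpTo⁻ (c +_) v∈
  ... | i , i<x∸c , refl = ∈-filter⁺ (_<? x) (⊆xs (m≤m+n c i) (<⇒≤ (<-≤-trans c+i<x x≤d))) c+i<x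
    where
    c+i<x : c + i < x
    c+i<x = subst (c + i <_) (m+[n∸m]≡n c≤x) (+-monoʳ-< c i<x∸c)

disjoint-intervals-order : ∀ {b₁ t₁ b₂ t₂ x k₁ k₂} →
  (∀ v → b₁ ≤ v → v ≤ t₁ → b₂ ≤ v → v ≤ t₂ → ⊥) →
  b₁ ≤ x → x ≤ t₁ → b₁ ≤ k₁ → k₁ ≤ t₁ → b₂ ≤ k₂ → k₂ ≤ t₂ →
  (t₂ < x → k₂ < k₁) × (k₂ < k₁ → t₂ < x)
disjoint-intervals-order {b₁} {t₁} {b₂} {t₂} {x} {k₁} {k₂} disjoint b₁≤x x≤t₁ b₁≤k₁ k₁≤t₁ b₂≤k₂ k₂≤t₂ =
  left⇒smaller , smaller⇒left
  where
  b₂≤t₂ : b₂ ≤ t₂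
  b₂≤t₂ = ≤-trans b₂≤k₂ k₂≤t₂
  left⇒smaller : t₂ < x → k₂ < k₁
  left⇒smaller t₂<x with k₁ ≤? t₂
  ... | yes k₁≤t₂ = ⊥-elim (disjoint t₂ (≤-trans b₁≤k₁ k₁≤t₂) (≤-trans (<⇒≤ t₂<x) x≤t₁) b₂≤t₂ ≤-refl)
  ... | no k₁≰t₂  = ≤-<-trans k₂≤t₂ (≰⇒> k₁≰t₂)
  smaller⇒left : k₂ < k₁ → t₂ < x
  smaller⇒left k₂<k₁ with x ≤? t₂ | k₁ ≤? t₂
  ... | no x≰t₂  | _         = ≰⇒> x≰t₂
  ... | yes _    | yes k₁≤t₂ = ⊥-elim (disjoint k₁ b₁≤k₁ k₁≤t₁ (≤-trans b₂≤k₂ (<⇒≤ k₂<k₁)) k₁≤t₂)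
  ... | yes x≤t₂ | no k₁≰t₂  =
    ⊥-elim (disjoint t₂ (≤-trans b₁≤x x≤t₂) (≤-trans (<⇒≤ (≰⇒> k₁≰t₂)) k₁≤t₁) b₂≤t₂ ≤-refl)

width : ℕ → ℕ → ℕ
width a b = suc b ∸ a

width-split : ∀ {a m b} → a ≤ suc m → m ≤ b → width a m + width (suc m) b ≡ width a b
width-split {a} {m} {b} a≤m+1 m≤b = begin
  (suc m ∸ a) + (suc b ∸ suc m) ≡⟨ +-comm (suc m ∸ a) (b ∸ m) ⟩
  (b ∸ m) + (suc m ∸ a)         ≡⟨ sym (+-∸-assoc (b ∸ m) a≤m+1) ⟩
  (b ∸ m) + suc m ∸ a           ≡⟨ cong (_∸ a) (trans (+-suc (b ∸ m) m) (cong suc (m∸n+n≡m m≤b))) ⟩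
  suc b ∸ a                     ∎
  where open ≡-Reasoning

width-positive : ∀ {a b} → a ≤ b → 1 ≤ width a b
width-positive {a} a≤b = subst (1 ≤_) (sym (+-∸-assoc 1 a≤b)) (s≤s z≤n)

-- bookkeeping of the bound when a first child is put in front of the remaining children
children-arith : ∀ s₁ s₂ c₁ c₂ w₁ w₂ K → s₁ + 2 ≤ c₁ + 2 * w₁ → s₂ + 2 * K ≤ c₂ + 2 * w₂ →
  (s₁ + s₂) + 2 * suc K ≤ (c₁ + c₂) + 2 * (w₁ + w₂)
children-arith s₁ s₂ c₁ c₂ w₁ w₂ K first rest =
  subst₂ _≤_ lhs rhs (+-mono-≤ first rest)
  where
  open +-*-Solver
  lhs : (s₁ + 2) + (s₂ + 2 * K) ≡ (s₁ + s₂) + 2 * suc K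
  lhs = solve 3 (λ a b k → (a :+ con 2) :+ (b :+ con 2 :* k) := (a :+ b) :+ con 2 :* (con 1 :+ k)) refl s₁ s₂ K
  rhs : (c₁ + 2 * w₁) + (c₂ + 2 * w₂) ≡ (c₁ + c₂) + 2 * (w₁ + w₂)
  rhs = solve 4 (λ a b x y → (a :+ con 2 :* x) :+ (b :+ con 2 :* y) := (a :+ b) :+ con 2 :* (x :+ y)) refl c₁ c₂ w₁ w₂

-- the node step: OPT(skeleton) = k ≤ K + A for K ≥ 2 children and A outside points,
-- the children's bound, and disjointness A + Σ ≤ L give the node's bound
node-arith : ∀ k s₁ s₂ K A Σ w L → k ≤ K + A → (s₁ + s₂) + 2 * K ≤ Σ + w → 2 ≤ K → A + Σ ≤ L →
  k + s₁ + s₂ + 2 ≤ L + w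
node-arith k s₁ s₂ K A Σ w L skel kids 2≤K disjoint = +-cancelˡ-≤ K _ _ (begin
  K + (k + s₁ + s₂ + 2) ≡⟨ solve 4 (λ k a b K → K :+ (k :+ a :+ b :+ con 2) := k :+ ((a :+ b) :+ (con 2 :+ K)))
                                refl k s₁ s₂ K ⟩
  k + (s + (2 + K))   ≤⟨ +-monoʳ-≤ k (+-monoʳ-≤ s (subst (2 + K ≤_) (solve 1 (λ K → K :+ K := con 2 :* K) refl K)
                                                         (+-monoˡ-≤ K 2≤K))) ⟩
  k + (s + 2 * K)     ≤⟨ +-mono-≤ skel kids ⟩
  (K + A) + (Σ + w)   ≡⟨ solve 4 (λ K A S w → (K :+ A) :+ (S :+ w) := K :+ ((A :+ S) :+ w)) refl K A Σ w ⟩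
  K + ((A + Σ) + w)   ≤⟨ +-monoʳ-≤ K (+-monoˡ-≤ w disjoint) ⟩
  K + (L + w)         ∎)
  where
  s : ℕ
  s = s₁ + s₂
  open ≤-Reasoning
  open +-*-Solver

<∸⇒+< : ∀ a b t → t < b ∸ a → a + t < b
<∸⇒+< zero    b       t t<b   = t<b
<∸⇒+< (suc a) (suc b) t t<b∸a = s≤s (<∸⇒+< a b t t<b∸a)

module Blocks (P : List ℕ) (uP : Unique P) where

  length-seg : ∀ a′ b → b ≤ length P → length (seg P (suc a′) b) ≡ b ∸ a′
  length-seg a′ b b≤n = trans (length-take (b ∸ a′) (drop a′ P))
    (trans (cong ((b ∸ a′) ⊓_) (length-drop a′ P)) (m≤n⇒m⊓n≡m (∸-monoˡ-≤ a′ b≤n)))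

  nth-seg : ∀ a′ b t → t < b ∸ a′ → nth (seg P (suc a′) b) t ≡ nth P (a′ + t)
  nth-seg a′ b t t< = trans (nth-take (b ∸ a′) (drop a′ P) t t<) (nth-drop a′ P t)

  seg-∈⁻ : ∀ {a b v} → 1 ≤ a → b ≤ length P → v ∈ seg P a b → ∃[ u ] (a ≤ u × u ≤ b × v ≡ at P u)
  seg-∈⁻ {suc a′} {b} _ b≤n v∈ with ∈⇒nth v∈
  ... | t , t< , v≡ rewrite length-seg a′ b b≤n =
    suc (a′ + t) , s≤s (m≤m+n a′ t) , <∸⇒+< a′ b t t< ,
    trans v≡ (trans (nth-seg a′ b t t<) (sym (at≡nth P (a′ + t))))

  seg-∈⁺ : ∀ {a b u} → 1 ≤ a → b ≤ length P → a ≤ u → u ≤ b → at P u ∈ seg P a b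
  seg-∈⁺ {suc a′} {b} {suc u′} _ b≤n (s≤s a≤u) u≤b =
    subst (_∈ seg P (suc a′) b) nth≡at
      (nth-∈ (seg P (suc a′) b) t (subst (t <_) (sym (length-seg a′ b b≤n)) t<))
    where
    t : ℕ
    t = u′ ∸ a′
    t< : t < b ∸ a′
    t< = ∸-monoˡ-< u≤b a≤u
    nth≡at : nth (seg P (suc a′) b) t ≡ at P (suc u′)
    nth≡at = trans (nth-seg a′ b t t<) (trans (cong (nth P) (m+[n∸m]≡n a≤u)) (sym (at≡nth P u′)))

  seg-unique : ∀ a b → Unique (seg P a b)
  seg-unique a b = take⁺ (suc b ∸ a) (drop⁺ (a ∸ 1) uP)

  at-injective : ∀ {u u′} → 1 ≤ u → u ≤ length P → 1 ≤ u′ → u′ ≤ length P → at P u ≡ at P u′ → u ≡ u′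
  at-injective {suc u} {suc u′} _ u≤n _ u′≤n e =
    cong suc (nth-injective uP u u′ u≤n u′≤n (trans (sym (at≡nth P u)) (trans e (at≡nth P u′))))

  lo hi : ∀ {a b} → IsBlock P a b → ℕ
  lo (_ , _ , _ , c , _)     = c
  hi (_ , _ , _ , _ , d , _) = d

  1≤start : ∀ {a b} → IsBlock P a b → 1 ≤ a
  1≤start (1≤a , _) = 1≤a

  start≤end : ∀ {a b} → IsBlock P a b → a ≤ b
  start≤end (_ , a≤b , _) = a≤b

  end≤length : ∀ {a b} → IsBlock P a b → b ≤ length P
  end≤length (_ , _ , b≤n , _) = b≤n

  values⊆ : ∀ {a b} (β : IsBlock P a b) {v} → v ∈ seg P a b → lo β ≤ v × v ≤ hi β
  values⊆ (_ , _ , _ , _ , _ , values≡) {v} = proj₁ (values≡ v)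

  ⊆values : ∀ {a b} (β : IsBlock P a b) {v} → lo β ≤ v → v ≤ hi β → v ∈ seg P a b
  ⊆values (_ , _ , _ , _ , _ , values≡) {v} lo≤v v≤hi = proj₂ (values≡ v) (lo≤v , v≤hi)

  at∈values : ∀ {a b} (β : IsBlock P a b) {u} → a ≤ u → u ≤ b → lo β ≤ at P u × at P u ≤ hi β
  at∈values β a≤u u≤b = values⊆ β (seg-∈⁺ (1≤start β) (end≤length β) a≤u u≤b)

  pattern-points : ∀ {a′ b} (β : IsBlock P (suc a′) b) {v i} → (v , i) ∈ points (std (seg P (suc a′) b)) →
    ∃[ u ] (suc a′ ≤ u × u ≤ b × v ≡ suc (at P u) ∸ lo β × i ≡ suc u ∸ suc a′)
  pattern-points {a′} {b} β {v} {i} z∈ with points∈⇒nth (std (seg P (suc a′) b)) z∈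
  ... | t , t<std , v≡ , i≡ = u , a≤u , u≤b , v≡normalised , i≡normalised
    where
    segment : List ℕ
    segment = seg P (suc a′) b
    t<segment : t < length segment
    t<segment = subst (t <_) (length-map _ segment) t<std
    t<b∸a′ : t < b ∸ a′
    t<b∸a′ = subst (t <_) (length-seg a′ b (end≤length β)) t<segment
    u : ℕ
    u = suc (a′ + t)
    a≤u : suc a′ ≤ u
    a≤u = s≤s (m≤m+n a′ t)
    u≤b : u ≤ b
    u≤b = <∸⇒+< a′ b t t<b∸a′
    lo≤xᵤ : lo β ≤ at P u
    lo≤xᵤ = proj₁ (at∈values β a≤u u≤b)
    v≡normalised : v ≡ suc (at P u) ∸ lo β
    v≡normalised = begin
      v                                                  ≡⟨ v≡ ⟩
      nth (std segment) t                                ≡⟨ nth-map _ segment t t<segment ⟩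
      suc (length (filter (_<? nth segment t) segment))  ≡⟨ cong (λ w → suc (length (filter (_<? w) segment)))
                                                             (trans (nth-seg a′ b t t<b∸a′) (sym (at≡nth P (a′ + t)))) ⟩
      suc (length (filter (_<? at P u) segment))         ≡⟨ cong suc (count-below-interval segment (lo β) (hi β) (at P u)
                                                             (seg-unique (suc a′) b) (values⊆ β) (⊆values β)
                                                             lo≤xᵤ (proj₂ (at∈values β a≤u u≤b))) ⟩
      suc (at P u ∸ lo β)                                ≡⟨ sym (+-∸-assoc 1 lo≤xᵤ) ⟩
      suc (at P u) ∸ lo β                                ∎
      where open ≡-Reasoning
    i≡normalised : i ≡ suc u ∸ suc a′
    i≡normalised = trans i≡ (sym (trans (cong (_∸ a′) (sym (+-suc a′ t))) (m+n∸m≡n a′ (suc t))))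

  record Block : Set where
    constructor block
    field
      start end : ℕ
      isBlock   : IsBlock P start end
  open Block public

  bottom top key : Block → ℕ
  bottom B = lo (isBlock B)
  top    B = hi (isBlock B)
  key    B = at P (start B)

  interval-ordered : ∀ B → start B ≤ end B
  interval-ordered B = start≤end (isBlock B)

  key∈values : ∀ B → bottom B ≤ key B × key B ≤ top B
  key∈values B = at∈values (isBlock B) ≤-refl (interval-ordered B)

  Region : Block → Point → Set
  Region B = InBox (bottom B) (top B) (start B) (end B)

  Region? : ∀ B → Decidable (Region B)
  Region? B = InBox? (bottom B) (top B) (start B) (end B)

  Consecutive : List Block → Set
  Consecutive = AllPairs (λ B C → end B < start C)

  startedBy : ℕ → List Block → ℕ
  startedBy y Bs = length (filter (λ C → start C <? suc y) Bs)

  startedBy-index : ∀ Bs → Consecutive Bs → ∀ {B} → B ∈ Bs → ∀ {y} → start B ≤ y → y ≤ end B →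
    ∃[ t ] (startedBy y Bs ≡ suc t × t < length Bs × nth (map key Bs) t ≡ key B)
  startedBy-index (B ∷ Cs) (B<Cs ∷ _) (here refl) {y} B≤y y≤B =
    0 , trans (cong length (filter-accept (λ C → start C <? suc y) (s≤s B≤y)))
              (cong suc (count-none (λ C → start C <? suc y) Cs
                 (λ C∈ → <⇒≱ (s≤s (≤-<-trans y≤B (All.lookup B<Cs C∈)))))) ,
    s≤s z≤n , refl
  startedBy-index (C ∷ Cs) (C<Cs ∷ consec) (there B∈) {y} B≤y y≤B
    with startedBy-index Cs consec B∈ B≤y y≤B
  ... | t , started≡ , t< , key≡ =
    suc t ,
    trans (cong length (filter-accept (λ C → start C <? suc y)
            (s≤s (≤-trans (interval-ordered C) (≤-trans (<⇒≤ (All.lookup C<Cs B∈)) B≤y)))))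
          (cong suc started≡) ,
    s≤s t< , key≡

  startedBy-surjective : ∀ Bs → Consecutive Bs → ∀ t → t < length Bs →
    ∃[ B ] (B ∈ Bs × startedBy (start B) Bs ≡ suc t)
  startedBy-surjective (B ∷ Cs) (B<Cs ∷ _) zero _ =
    B , here refl ,
    trans (cong length (filter-accept (λ C → start C <? suc (start B)) ≤-refl))
          (cong suc (count-none (λ C → start C <? suc (start B)) Cs
             (λ C∈ → <⇒≱ (s≤s (≤-<-trans (interval-ordered B) (All.lookup B<Cs C∈))))))
  startedBy-surjective (C ∷ Cs) (C<Cs ∷ consec) (suc t) (s≤s t<) with startedBy-surjective Cs consec t t<
  ... | B , B∈ , started≡ =
    B , there B∈ ,
    trans (cong length (filter-accept (λ D → start D <? suc (start B))
            (s≤s (≤-trans (interval-ordered C) (<⇒≤ (All.lookup C<Cs B∈))))))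
          (cong suc started≡)

  shared-time⇒≡ : ∀ {Bs} → Consecutive Bs → ∀ {B C} → B ∈ Bs → C ∈ Bs → ∀ {y} →
    start B ≤ y → y ≤ end B → start C ≤ y → y ≤ end C → B ≡ C
  shared-time⇒≡ _ (here refl) (here refl) _ _ _ _ = refl
  shared-time⇒≡ (B<Cs ∷ _) (here refl) (there C∈) _ y≤B C≤y _ =
    ⊥-elim (<⇒≱ (<-≤-trans (All.lookup B<Cs C∈) C≤y) y≤B)
  shared-time⇒≡ (C<Bs ∷ _) (there B∈) (here refl) B≤y _ _ y≤C =
    ⊥-elim (<⇒≱ (<-≤-trans (All.lookup C<Bs B∈) B≤y) y≤C)
  shared-time⇒≡ (_ ∷ consec) (there B∈) (there C∈) B≤y y≤B C≤y y≤C =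
    shared-time⇒≡ consec B∈ C∈ B≤y y≤B C≤y y≤C

  ≡⊎disjoint : ∀ {Bs} → Consecutive Bs → ∀ {B C} → B ∈ Bs → C ∈ Bs → B ≡ C ⊎ B ≢ C
  ≡⊎disjoint consec {B} {C} B∈ C∈ with start C ≤? start B | start B ≤? end C
  ... | yes C≤B | yes B≤C = inj₁ (shared-time⇒≡ consec B∈ C∈ ≤-refl (interval-ordered B) C≤B B≤C)
  ... | no C≰B  | _       = inj₂ (λ { refl → C≰B ≤-refl })
  ... | yes _   | no B≰C  = inj₂ (λ { refl → B≰C (interval-ordered B) })

  -- distinct blocks of a consecutive list have disjoint value ranges, since P is injective
  values-disjoint : ∀ {Bs} → Consecutive Bs → ∀ {B C} → B ∈ Bs → C ∈ Bs → B ≢ C →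
    ∀ v → bottom B ≤ v → v ≤ top B → bottom C ≤ v → v ≤ top C → ⊥
  values-disjoint consec {B} {C} B∈ C∈ B≢C v B≤v v≤B C≤v v≤C
    with seg-∈⁻ (1≤start (isBlock B)) (end≤length (isBlock B)) (⊆values (isBlock B) B≤v v≤B)
       | seg-∈⁻ (1≤start (isBlock C)) (end≤length (isBlock C)) (⊆values (isBlock C) C≤v v≤C)
  ... | u , B≤u , u≤B , v≡ | u′ , C≤u′ , u′≤C , v≡′ =
    B≢C (shared-time⇒≡ consec B∈ C∈ B≤u u≤B (subst (start C ≤_) (sym u≡u′) C≤u′)
                                             (subst (_≤ end C) (sym u≡u′) u′≤C))
    where
    u≡u′ : u ≡ u′
    u≡u′ = at-injective (≤-trans (1≤start (isBlock B)) B≤u) (≤-trans u≤B (end≤length (isBlock B)))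
                        (≤-trans (1≤start (isBlock C)) C≤u′) (≤-trans u′≤C (end≤length (isBlock C)))
                        (trans (sym v≡) v≡′)

  below⇔key< : ∀ {Bs} → Consecutive Bs → ∀ {B C} → B ∈ Bs → C ∈ Bs → ∀ {x} →
    bottom B ≤ x → x ≤ top B → (top C < x → key C < key B) × (key C < key B → top C < x)
  below⇔key< consec {B} {C} B∈ C∈ B≤x x≤B with ≡⊎disjoint consec B∈ C∈
  ... | inj₁ refl = (λ B<x → ⊥-elim (<⇒≱ B<x x≤B)) , (λ k<k → ⊥-elim (<-irrefl refl k<k))
  ... | inj₂ B≢C  = disjoint-intervals-order (values-disjoint consec B∈ C∈ B≢C) B≤x x≤B
                      (proj₁ (key∈values B)) (proj₂ (key∈values B))
                      (proj₁ (key∈values C)) (proj₂ (key∈values C))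

  -- the monotone map contracting every region of a consecutive list Bs to a point of the
  -- skeleton of Bs: value x goes to 1 + #{blocks lying below x}, time y to #{blocks started by y}
  module Contraction (Bs : List Block) (consec : Consecutive Bs) where

    column row : ℕ → ℕ
    column x = suc (length (filter (λ C → top C <? x) Bs))
    row    y = startedBy y Bs

    column-mono : Monotone column
    column-mono x≤x′ = s≤s (count-mono (λ C → top C <? _) (λ C → top C <? _) (λ _ C<x → <-≤-trans C<x x≤x′) Bs)

    row-mono : Monotone row
    row-mono y≤y′ = count-mono (λ C → start C <? _) (λ C → start C <? _) (λ _ C≤y → <-≤-trans C≤y (s≤s y≤y′)) Bs

    skel : List ℕ
    skel = std (map key Bs)

    length-skel : length skel ≡ length Bs
    length-skel = trans (length-map _ (map key Bs)) (length-map key Bs)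

    column≡rank : ∀ {B} → B ∈ Bs → ∀ {x} → bottom B ≤ x → x ≤ top B →
      column x ≡ suc (length (filter (_<? key B) (map key Bs)))
    column≡rank {B} B∈ B≤x x≤B = cong suc (begin
      length (filter (λ C → top C <? _) Bs)       ≡⟨ count-cong (λ C → top C <? _) (λ C → key C <? key B) Bs
                                                        (λ C∈ → below⇔key< consec B∈ C∈ B≤x x≤B) ⟩
      length (filter (λ C → key C <? key B) Bs)   ≡⟨ sym (count-map (_<? key B) key Bs) ⟩
      length (filter (_<? key B) (map key Bs))    ∎)
      where open ≡-Reasoning

    region↦skeleton : ∀ {B} → B ∈ Bs → ∀ {x y} → Region B (x , y) →
      ∃[ t ] (row y ≡ suc t × t < length Bs × column x ≡ nth skel t)
    region↦skeleton {B} B∈ {x} (B≤x , x≤B , B≤y , y≤B) with startedBy-index Bs consec B∈ B≤y y≤B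
    ... | t , row≡ , t< , key≡ =
      t , row≡ , t< ,
      trans (column≡rank B∈ B≤x x≤B)
            (sym (trans (nth-map rank (map key Bs) t (subst (t <_) (sym (length-map key Bs)) t<))
                        (cong rank key≡)))
      where
      rank : ℕ → ℕ
      rank v = suc (length (filter (_<? v) (map key Bs)))

module Trees (P : List ℕ) (uP : Unique P) where
  open Blocks P uP

  PointsOf : ℕ → ℕ → List Point → Set
  PointsOf a b S = ∀ u → a ≤ u → u ≤ b → (at P u , u) ∈ S

  points⊆⇒PointsOf : ∀ {S} → All (_∈ S) (points P) → PointsOf 1 (length P) S
  points⊆⇒PointsOf P⊆S (suc u) _ u<n =
    All.lookup P⊆S (subst (λ v → (v , suc u) ∈ points P) (sym (at≡nth P u)) (nth∈points P u u<n))

  restrict-satisfied-region : ∀ B S → Satisfied S → Satisfied (filter (Region? B) S)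
  restrict-satisfied-region B = restrict-satisfied (Region? B) (InBox-convex (bottom B) (top B) (start B) (end B))

  restrict-points-region : ∀ B S → PointsOf (start B) (end B) S → PointsOf (start B) (end B) (filter (Region? B) S)
  restrict-points-region B S has-points u B≤u u≤B =
    ∈-filter⁺ (Region? B) (has-points u B≤u u≤B)
      (proj₁ (at∈values (isBlock B) B≤u u≤B) , proj₂ (at∈values (isBlock B) B≤u u≤B) , B≤u , u≤B)

  -- a leaf: normalising the region of B to [1,|B|]² maps the points of S there onto a
  -- satisfied superset of the points of the pattern of B, so OPT(pattern) ≤ |S ∩ region|
  leaf-bound : ∀ B {k} → IsOPT (std (seg P (start B) (end B))) k → ∀ S → Satisfied S →
    PointsOf (start B) (end B) S → k ≤ length (filter (Region? B) S)
  leaf-bound (block zero _ β) _ _ _ _ with 1≤start β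
  ... | ()
  leaf-bound B@(block (suc a′) b β) opt S satS has-points =
    ≤-trans (OPT≤ (map image S′) (map image S′) opt (image-satisfied S′ satS′) pattern⊆image (λ z∈ → z∈))
            (≤-reflexive (length-map image S′))
    where
    S′ : List Point
    S′ = filter (Region? B) S
    satS′ : Satisfied S′
    satS′ = restrict-satisfied-region B S satS
    open MonotoneImage (λ x → suc x ∸ lo β) (λ y → suc y ∸ suc a′)
           (λ x≤x′ → ∸-monoˡ-≤ (lo β) (s≤s x≤x′)) (λ y≤y′ → ∸-monoˡ-≤ (suc a′) (s≤s y≤y′))
    pattern⊆image : ∀ {z} → z ∈ points (std (seg P (suc a′) b)) → z ∈ map image S′
    pattern⊆image z∈ with pattern-points β z∈
    ... | u , a≤u , u≤b , refl , refl = ∈-map⁺ image (restrict-points-region B S has-points u a≤u u≤b)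

  InSomeRegion : List Block → Point → Set
  InSomeRegion Bs p = Any (λ B → Region B p) Bs

  outside : List Block → List Point → List Point
  outside Bs = filter (λ p → ¬? (any? (λ B → Region? B p) Bs))

  inRegions : List Point → List Block → ℕ
  inRegions S []       = 0
  inRegions S (B ∷ Bs) = length (filter (Region? B) S) + inRegions S Bs

  -- regions of a consecutive list are disjoint, so their counts and the points outside
  -- all of them add up to at most |S|
  outside+inRegions≤ : ∀ Bs → Consecutive Bs → ∀ S → length (outside Bs S) + inRegions S Bs ≤ length S
  outside+inRegions≤ []       []               S = subst (_≤ length S) (sym (+-identityʳ _)) (length-filter _ S)
  outside+inRegions≤ (B ∷ Bs) (B<Bs ∷ consec) S = begin
    length (outside (B ∷ Bs) S) + (length (filter (Region? B) S) + inRegions S Bs)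
      ≡⟨ sym (+-assoc (length (outside (B ∷ Bs) S)) _ _) ⟩
    length (outside (B ∷ Bs) S) + length (filter (Region? B) S) + inRegions S Bs
      ≤⟨ +-monoˡ-≤ (inRegions S Bs) (count-disjoint _ (Region? B) _
            (λ _ out inB → out (here inB)) (λ _ out inBs → out (there inBs))
            (λ p inB inBs → only-B p inB inBs) S) ⟩
    length (outside Bs S) + inRegions S Bs
      ≤⟨ outside+inRegions≤ Bs consec S ⟩
    length S ∎
    where
    open ≤-Reasoning
    only-B : ∀ p → Region B p → InSomeRegion Bs p → ⊥
    only-B p (_ , _ , _ , p≤B) inBs with find inBs
    ... | C , C∈ , (_ , _ , C≤p , _) = <⇒≱ (<-≤-trans (All.lookup B<Bs C∈) C≤p) p≤B

  -- the skeleton of a consecutive list Bs: contracting every region to a point maps S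
  -- onto a satisfied superset of the skeleton's points, made of one point per block and
  -- the images of the points outside all regions
  skeleton-bound : ∀ Bs → Consecutive Bs → ∀ S → Satisfied S →
    (∀ {B} → B ∈ Bs → (key B , start B) ∈ S) →
    ∀ {k} → IsOPT (std (map key Bs)) k → k ≤ length Bs + length (outside Bs S)
  skeleton-bound Bs consec S satS keys∈S {k} opt =
    subst (k ≤_) length-cover (OPT≤ (map image S) cover opt (image-satisfied S satS) skeleton⊆image image⊆cover)
    where
    open Contraction Bs consec
    open MonotoneImage column row column-mono row-mono
    cover : List Point
    cover = points skel ++ map image (outside Bs S)

    length-cover : length cover ≡ length Bs + length (outside Bs S)
    length-cover = trans (length-++ (points skel))
      (cong₂ _+_ (trans (length-points skel) length-skel) (length-map image (outside Bs S)))

    skeleton⊆image : ∀ {z} → z ∈ points skel → z ∈ map image S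
    skeleton⊆image {v , i} z∈ with points∈⇒nth skel z∈
    ... | t , t< , v≡ , i≡ with startedBy-surjective Bs consec t (subst (t <_) length-skel t<)
    ... | B , B∈ , row≡ with region↦skeleton B∈ {key B} {start B}
                               (proj₁ (key∈values B) , proj₂ (key∈values B) , ≤-refl , interval-ordered B)
    ... | t′ , row≡′ , _ , column≡ = subst (_∈ map image S) image≡ (∈-map⁺ image (keys∈S B∈))
      where
      t′≡t : t′ ≡ t
      t′≡t = suc-injective (trans (sym row≡′) row≡)
      image≡ : image (key B , start B) ≡ (v , i)
      image≡ = cong₂ _,_ (trans column≡ (trans (cong (nth skel) t′≡t) (sym v≡))) (trans row≡ (sym i≡))

    image⊆cover : ∀ {z} → z ∈ map image S → z ∈ cover
    image⊆cover z∈ with ∈-map⁻ image z∈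
    ... | p , p∈S , refl with any? (λ B → Region? B p) Bs
    ...   | no out = ∈-++⁺ʳ (points skel) (∈-map⁺ image (∈-filter⁺ _ p∈S out))
    ...   | yes inBs with find inBs
    ...     | B , B∈ , inB with region↦skeleton B∈ inB
    ...       | t , row≡ , t< , column≡ =
      ∈-++⁺ˡ (subst (_∈ points skel) (sym (cong₂ _,_ column≡ row≡))
                    (nth∈points skel t (subst (t <_) (sym length-skel) t<)))

  blockOf : ∀ {a b} → BDT P a b → IsBlock P a b
  blockOf (leaf β)     = β
  blockOf (node β _ _) = β

  root : ∀ {a b} → BDT P a b → Block
  root {a} {b} t = block a b (blockOf t)

  children : ∀ {a b} → Kids P a b → List Block
  children (lastK t)    = root t ∷ []
  children (consK t ks) = root t ∷ children ks

  kids-start≤end : ∀ {a b} → Kids P a b → a ≤ b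
  kids-start≤end (lastK t)    = start≤end (blockOf t)
  kids-start≤end (consK t ks) = ≤-trans (start≤end (blockOf t)) (≤-trans (n≤1+n _) (kids-start≤end ks))

  children-within : ∀ {a b} (ks : Kids P a b) → All (λ B → a ≤ start B × end B ≤ b) (children ks)
  children-within (lastK t)             = (≤-refl , ≤-refl) ∷ []
  children-within (consK {m = m} t ks) =
    (≤-refl , ≤-trans (n≤1+n m) (kids-start≤end ks)) ∷
    All.map (λ { (m<B , B≤b) → ≤-trans (m≤n⇒m≤1+n (start≤end (blockOf t))) m<B , B≤b }) (children-within ks)

  children-consecutive : ∀ {a b} (ks : Kids P a b) → Consecutive (children ks)
  children-consecutive (lastK t)    = [] ∷ []
  children-consecutive (consK t ks) = All.map proj₁ (children-within ks) ∷ children-consecutive ks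

  keys≡map-key : ∀ {a b} (ks : Kids P a b) → keys ks ≡ map key (children ks)
  keys≡map-key (lastK t)    = refl
  keys≡map-key (consK t ks) = cong (_ ∷_) (keys≡map-key ks)

  PointsOf-⊆ : ∀ {a b a′ b′ S} → a ≤ a′ → b′ ≤ b → PointsOf a b S → PointsOf a′ b′ S
  PointsOf-⊆ a≤a′ b′≤b has-points u a′≤u u≤b′ = has-points u (≤-trans a≤a′ a′≤u) (≤-trans u≤b′ b′≤b)

  children-≥2 : ∀ {a m b} (t : BDT P a m) (ks : Kids P (suc m) b) → 2 ≤ length (children (consK t ks))
  children-≥2 t (lastK _)    = s≤s (s≤s z≤n)
  children-≥2 t (consK _ _) = s≤s (s≤s z≤n)

  mutual
    tree-bound : ∀ {a b s} (t : BDT P a b) → TreeSum t s → ∀ S → Satisfied S → PointsOf a b S →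
      s + 2 ≤ length S + 2 * width a b
    tree-bound (leaf β) (leafS opt) S satS has-points =
      +-mono-≤ (≤-trans (leaf-bound (block _ _ β) opt S satS has-points) (length-filter _ S))
               (*-monoʳ-≤ 2 (width-positive (start≤end β)))
    tree-bound {a} {b} (node β t ks) (nodeS {k = k} {s₁ = s₁} {s₂ = s₂} opt ts ksS) S satS has-points =
      node-arith k s₁ s₂ (length Bs) (length (outside Bs S′)) (inRegions S′ Bs) (2 * width a b) (length S)
        skeleton-opt kids (children-≥2 t ks) counts
      where
      N : Block
      N = block a b β
      Bs : List Block
      Bs = children (consK t ks)
      S′ : List Point
      S′ = filter (Region? N) S
      satS′ : Satisfied S′
      satS′ = restrict-satisfied-region N S satS
      has-points′ : PointsOf a b S′
      has-points′ = restrict-points-region N S has-points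
      keys∈S′ : ∀ {B} → B ∈ Bs → (key B , start B) ∈ S′
      keys∈S′ {B} B∈ with All.lookup (children-within (consK t ks)) B∈
      ... | a≤B , B≤b = has-points′ (start B) a≤B (≤-trans (interval-ordered B) B≤b)
      skeleton-opt : k ≤ length Bs + length (outside Bs S′)
      skeleton-opt = skeleton-bound Bs (children-consecutive (consK t ks)) S′ satS′ keys∈S′
                   (subst (λ q → IsOPT (std q) k) (cong (at P a ∷_) (keys≡map-key ks)) opt)
      kids : (s₁ + s₂) + 2 * length Bs ≤ inRegions S′ Bs + 2 * width a b
      kids = first-and-rest-bound t ts ks ksS S′ satS′ has-points′
      counts : length (outside Bs S′) + inRegions S′ Bs ≤ length S
      counts = ≤-trans (outside+inRegions≤ Bs (children-consecutive (consK t ks)) S′) (length-filter _ S)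

    kids-bound : ∀ {a b s} (ks : Kids P a b) → KidsSum ks s → ∀ X → Satisfied X → PointsOf a b X →
      s + 2 * length (children ks) ≤ inRegions X (children ks) + 2 * width a b
    kids-bound {a} {b} {s} (lastK t) (lastS ts) X satX has-points =
      subst (λ c → s + 2 ≤ c + 2 * width a b) (sym (+-identityʳ inside)) (child-bound t ts X satX has-points)
      where
      inside : ℕ
      inside = length (filter (Region? (root t)) X)
    kids-bound (consK t ks) (consS ts ksS) = first-and-rest-bound t ts ks ksS

    first-and-rest-bound : ∀ {a m b s₁ s₂} (t : BDT P a m) → TreeSum t s₁ → (ks : Kids P (suc m) b) →
      KidsSum ks s₂ → ∀ X → Satisfied X → PointsOf a b X →
      (s₁ + s₂) + 2 * length (children (consK t ks)) ≤ inRegions X (children (consK t ks)) + 2 * width a b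
    first-and-rest-bound {a} {m} {b} {s₁} {s₂} t ts ks ksS X satX has-points =
      subst (λ w → (s₁ + s₂) + 2 * suc (length (children ks)) ≤ inRegions X (children (consK t ks)) + 2 * w)
            (width-split a≤m+1 m≤b)
            (children-arith s₁ s₂ (length (filter (Region? (root t)) X)) (inRegions X (children ks))
                            (width a m) (width (suc m) b) (length (children ks))
                            (child-bound t ts X satX (PointsOf-⊆ ≤-refl m≤b has-points))
                            (kids-bound ks ksS X satX (PointsOf-⊆ a≤m+1 ≤-refl has-points)))
      where
      a≤m+1 : a ≤ suc m
      a≤m+1 = m≤n⇒m≤1+n (start≤end (blockOf t))
      m≤b : m ≤ b
      m≤b = ≤-trans (n≤1+n m) (kids-start≤end ks)

    child-bound : ∀ {a b s} (t : BDT P a b) → TreeSum t s → ∀ X → Satisfied X → PointsOf a b X →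
      s + 2 ≤ length (filter (Region? (root t)) X) + 2 * width a b
    child-bound t ts X satX has-points =
      tree-bound t ts (filter (Region? (root t)) X) (restrict-satisfied-region (root t) X satX)
        (restrict-points-region (root t) X has-points)

perm-unique : ∀ {n P} → IsPerm n P → Unique P
perm-unique {n} P↭ = PermSetoid.Unique-resp-↭ (setoid ℕ) (↭⇒↭ₛ (↭-sym P↭))
  (applyUpTo⁺₁ suc n (λ i<j _ e → <⇒≢ i<j (suc-injective e)))

mainTheorem12 : (n : ℕ) (P : List ℕ) → IsPerm n P → (T : BDT P 1 n) →
    (s m : ℕ) → TreeSum T s → IsOPT P m → s ≤ m + 2 * n
mainTheorem12 n P P↭ T s m treeSum ((S , (_ , P⊆S , satS) , |S|≡m) , _) =
  ≤-trans (m≤m+n s 2) (subst (λ w → s + 2 ≤ w + 2 * n) |S|≡m (tree-bound T treeSum S satS S-has-points))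
  where
  open Trees P (perm-unique P↭)
  S-has-points : PointsOf 1 n S
  S-has-points = subst (λ w → PointsOf 1 w S) (trans (↭-length P↭) (length-applyUpTo suc n))
                       (points⊆⇒PointsOf P⊆S)
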